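{- Let $j\ge1$ and let $H=(V,E_H,c_H)$ be a $j$-tree with core $C_H=(C,E_C,c_C)$, the subgraph of $H$ induced by $C\subseteq V$. Then for every $S\subseteq V$, $c_H(\Pi(S\cap C))\le c_H(S)$.
   Context: A $j$-tree is a connected graph $H$ that is the union of a core, the subgraph induced by a vertex set $C$ with $|C|\le j$, and an envelope, a forest on all vertices of $H$ in which every component contains exactly one vertex of $C$. For $u\in C$, $F(u)$ is the vertex set of the envelope component containing $u$. For $X\subseteq C$, the core cut is $\Pi(X)=\bigcup_{u\in X}F(u)$. For $S\subseteq V$, $c_H(S)$ is the total capacity of edges of $H$ with exactly one endpoint in $S$.
   Formalization: The edge capacities $c_H$ of the j-tree H take values in the nonnegative rationals. -}

module Defs where

open import Data.Nat using (ℕ; _≤_)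
open import Data.Fin using (Fin)
open import Data.Fin.Subset using (Subset; _∈_; ∣_∣)
open import Data.Bool using (if_then_else_; _xor_)
open import Data.Vec using () renaming (lookup to vlookup)
open import Data.Rational using (ℚ; 0ℚ; _+_) renaming (_≤_ to _≤ℚ_)
open import Data.List using (List; foldr; length; lookup; removeAt) renaming (_++_ to _++ᴸ_)
open import Data.List.Relation.Unary.All using (All)
open import Data.List.Relation.Binary.Permutation.Propositional using (_↭_)
import Data.List.Membership.Propositional as M
open import Data.Product using (Σ; ∃; _×_; _,_; proj₁; proj₂)
open import Data.Sum using (_⊎_)
open import Relation.Binary.PropositionalEquality using (_≡_)
open import Relation.Binary.Construct.Closure.ReflexiveTransitive using (Star)
open import Relation.Nullary using (¬_)

-- An undirected capacitated edge {u,v} with capacity c, written (u , v , c).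
Edge : ℕ → Set
Edge n = Fin n × Fin n × ℚ

Graph : ℕ → Set
Graph n = List (Edge n)

NonnegCap : ∀ {n} → Graph n → Set
NonnegCap E = All (λ e → 0ℚ ≤ℚ proj₂ (proj₂ e)) E

Adj : ∀ {n} → Graph n → Fin n → Fin n → Set
Adj E u w = ∃ λ c → ((u , w , c) M.∈ E) ⊎ ((w , u , c) M.∈ E)

Reach : ∀ {n} → Graph n → Fin n → Fin n → Set
Reach E = Star (Adj E)

Connected : ∀ {n} → Graph n → Set
Connected {n} E = (u v : Fin n) → Reach E u v

-- A forest: no edge has its endpoints connected by the remaining edges
-- (this also excludes self-loops).
Forest : ∀ {n} → Graph n → Set
Forest E = (i : Fin (length E)) →
  ¬ Reach (removeAt E i) (proj₁ (lookup E i)) (proj₁ (proj₂ (lookup E i)))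

cut : ∀ {n} → Graph n → Subset n → ℚ
cut E S = foldr (λ e acc →
    (if vlookup S (proj₁ e) xor vlookup S (proj₁ (proj₂ e))
     then proj₂ (proj₂ e) else 0ℚ) + acc) 0ℚ E

-- Data of a j-tree decomposition of H with core vertex set C:
-- H is the union of the core (subgraph induced by C) and an envelope forest
-- spanning all vertices, each of whose components contains exactly one vertex of C.
record JTree {n : ℕ} (j : ℕ) (H : Graph n) (C : Subset n) : Set where
  field
    connected   : Connected H
    core-size   : ∣ C ∣ ≤ j
    coreEdges   : Graph n
    envelope    : Graph n
    union       : H ↭ (coreEdges ++ᴸ envelope)
    core-inside : All (λ e → (proj₁ e ∈ C) × (proj₁ (proj₂ e) ∈ C)) coreEdges
    env-forest  : Forest envelope
    env-hasCore : (v : Fin n) → ∃ λ u → (u ∈ C) × Reach envelope u v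
    env-unique  : (v u u′ : Fin n) → u ∈ C → u′ ∈ C →
                  Reach envelope u v → Reach envelope u′ v → u ≡ u′

-- Π(X) for X ⊆ C, as a characterizing property of a subset T:
-- T = ⋃_{u ∈ X} F(u), F(u) the envelope component of u.
IsCoreCut : ∀ {n} → Graph n → Subset n → Subset n → Set
IsCoreCut {n} env X T = (v : Fin n) →
  ((v ∈ T) → ∃ λ u → (u ∈ X) × Reach env u v) ×
  ((∃ λ u → (u ∈ X) × Reach env u v) → v ∈ T)

module Submission where

-- An edge e = {u,v} contributes its capacity to c_H(T) exactly
-- when T separates u and v; so c_H(T) ≤ c_H(S) follows edge by edge once
-- every edge crossing T = Π(S ∩ C) also crosses S.  Every edge of H is a
-- core edge or an envelope edge:
--   * T agrees with S on the core C: a core vertex u lies in Π(S ∩ C) iff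
--     its own envelope component hangs off a vertex of S ∩ C, and since each
--     component contains only one core vertex, that vertex is u itself.
--     Hence a core edge crosses T iff it crosses S.
--   * T is a union of envelope components, so no envelope edge crosses T,
--     and its contribution 0 is at most its (nonnegative) contribution to S.

open import Defs
open import Data.Nat using (ℕ; _≤_)
open import Data.Fin.Subset using (Subset; _∩_)
open import Data.Rational using () renaming (_≤_ to _≤ℚ_)

open import Data.Fin using (Fin)
open import Data.Fin.Subset using (_∈_)
open import Data.Fin.Subset.Properties using (x∈p∩q⁺; p∩q⊆p; p∩q⊆q)
open import Data.Bool using (true; false; if_then_else_; _xor_)
open import Data.Vec using () renaming (lookup to vlookup)
open import Data.Vec.Properties using ([]=⇒lookup; lookup⇒[]=)
open import Data.Rational using (ℚ; 0ℚ)
open import Data.Rational.Properties using (+-mono-≤; ≤-refl; ≤-reflexive)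
open import Data.List using ([]; _∷_)
open import Data.List.Relation.Unary.All as All using (All; []; _∷_)
open import Data.List.Relation.Binary.Permutation.Propositional.Properties using (∈-resp-↭)
open import Data.List.Membership.Propositional.Properties using (∈-++⁻)
import Data.List.Membership.Propositional as List
open import Data.Product using (_,_; proj₁; proj₂)
open import Data.Sum using (inj₁; inj₂)
open import Relation.Binary.PropositionalEquality using (_≡_; refl; sym; trans; subst)
open import Relation.Binary.Construct.Closure.ReflexiveTransitive using (ε; _◅_; _◅◅_)

crossing : ∀ {n} → Subset n → Edge n → ℚ
crossing S (u , v , c) = if vlookup S u xor vlookup S v then c else 0ℚ

cut-mono : ∀ {n} (T S : Subset n) (E : Graph n) →
  All (λ e → crossing T e ≤ℚ crossing S e) E → cut E T ≤ℚ cut E S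
cut-mono T S []      []       = ≤-refl
cut-mono T S (e ∷ E) (p ∷ ps) = +-mono-≤ p (cut-mono T S E ps)

crossing-nonneg : ∀ {n} (S : Subset n) (e : Edge n) →
  0ℚ ≤ℚ proj₂ (proj₂ e) → 0ℚ ≤ℚ crossing S e
crossing-nonneg S (u , v , c) 0≤c with vlookup S u xor vlookup S v
... | true  = 0≤c
... | false = ≤-refl

crossing-same-side : ∀ {n} (T : Subset n) (u v : Fin n) (c : ℚ) →
  vlookup T u ≡ vlookup T v → crossing T (u , v , c) ≡ 0ℚ
crossing-same-side T u v c eq with vlookup T u | vlookup T v
crossing-same-side T u v c refl | true  | _ = refl
crossing-same-side T u v c refl | false | _ = refl

crossing-agree : ∀ {n} (T S : Subset n) (u v : Fin n) (c : ℚ) →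
  vlookup T u ≡ vlookup S u → vlookup T v ≡ vlookup S v →
  crossing T (u , v , c) ≡ crossing S (u , v , c)
crossing-agree T S u v c eqᵤ eqᵥ rewrite eqᵤ | eqᵥ = refl

lookup-≡ : ∀ {n} (T S : Subset n) (x y : Fin n) →
  (x ∈ T → y ∈ S) → (y ∈ S → x ∈ T) → vlookup T x ≡ vlookup S y
lookup-≡ T S x y T⇒S S⇒T with vlookup T x in eqT | vlookup S y in eqS
... | true  | true  = refl
... | false | false = refl
... | true  | false = trans (sym ([]=⇒lookup (T⇒S (lookup⇒[]= x T eqT)))) eqS
... | false | true  = sym (trans (sym ([]=⇒lookup (S⇒T (lookup⇒[]= y S eqS)))) eqT)

adj-sym : ∀ {n} {E : Graph n} {u v : Fin n} → Adj E u v → Adj E v u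
adj-sym (c , inj₁ uv∈E) = c , inj₂ uv∈E
adj-sym (c , inj₂ vu∈E) = c , inj₁ vu∈E

module CoreCut {n : ℕ} {env : Graph n} {X T : Subset n}
               (isCut : IsCoreCut env X T) where

  contains : ∀ {u} → u ∈ X → u ∈ T
  contains {u} u∈X = proj₂ (isCut u) (u , u∈X , ε)

  closed : ∀ {u v} → Adj env u v → u ∈ T → v ∈ T
  closed {u} {v} adj u∈T with proj₁ (isCut u) u∈T
  ... | w , w∈X , w⇝u = proj₂ (isCut v) (w , w∈X , w⇝u ◅◅ (adj ◅ ε))

  same-side : ∀ {u v} → Adj env u v → vlookup T u ≡ vlookup T v
  same-side {u} {v} adj = lookup-≡ T T u v (closed adj) (closed (adj-sym adj))

  core-reflects : {C : Subset n} →
    (∀ v u u′ → u ∈ C → u′ ∈ C → Reach env u v → Reach env u′ v → u ≡ u′) →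
    (∀ {u} → u ∈ X → u ∈ C) → ∀ {u} → u ∈ C → u ∈ T → u ∈ X
  core-reflects unique X⊆C {u} u∈C u∈T with proj₁ (isCut u) u∈T
  ... | w , w∈X , w⇝u with unique u w u (X⊆C w∈X) u∈C w⇝u ε
  ... | refl = w∈X

module JTreeCut {n j : ℕ} {H : Graph n} {C : Subset n} (J : JTree j H C)
                {S T : Subset n} (isCut : IsCoreCut (JTree.envelope J) (S ∩ C) T) where
  open JTree J
  open CoreCut isCut

  agrees-on-core : ∀ {u} → u ∈ C → vlookup T u ≡ vlookup S u
  agrees-on-core {u} u∈C = lookup-≡ T S u u
    (λ u∈T → p∩q⊆p S C (core-reflects env-unique (p∩q⊆q S C) u∈C u∈T))
    (λ u∈S → contains (x∈p∩q⁺ (u∈S , u∈C)))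

  edge-dominated : ∀ (e : Edge n) → e List.∈ H → 0ℚ ≤ℚ proj₂ (proj₂ e) →
    crossing T e ≤ℚ crossing S e
  edge-dominated e@(u , v , c) e∈H 0≤c with ∈-++⁻ coreEdges (∈-resp-↭ union e∈H)
  ... | inj₁ e∈core = let (u∈C , v∈C) = All.lookup core-inside e∈core in
    ≤-reflexive (crossing-agree T S u v c (agrees-on-core u∈C) (agrees-on-core v∈C))
  ... | inj₂ e∈env = subst (_≤ℚ crossing S e)
    (sym (crossing-same-side T u v c (same-side (c , inj₁ e∈env))))
    (crossing-nonneg S e 0≤c)

lemma6p15 : (n j : ℕ) → 1 ≤ j → (H : Graph n) → NonnegCap H →
    (C : Subset n) → (J : JTree j H C) →
    (S T : Subset n) → IsCoreCut (JTree.envelope J) (S ∩ C) T →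
    cut H T ≤ℚ cut H S
lemma6p15 n j _ H nonneg C J S T isCut =
  cut-mono T S H (All.tabulate λ {e} e∈H → edge-dominated e e∈H (All.lookup nonneg e∈H))
  where open JTreeCut J isCut
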